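{- Let $k_1,\ldots,k_n\ge 2$ be integers, $G=[0,k_1-1]\times\cdots\times[0,k_n-1]$ and $N=\sum_{i=1}^n(k_i-1)$. Let $d,w\in[0,N]$ with $d<w$. Then, as functions on $\underline{w}$, \[ \mathbb{Y}^{(\alpha)}=\frac{1}{w-d}\sum_{\substack{\beta\in\underline{d+1}\\ \beta\ge\alpha}}\mathbb{Y}^{(\beta)}\quad\text{for all }\alpha\in\underline{d}. \]
   Context: For integers $a\le b$, $[a,b]$ is the set of integers between $a$ and $b$. For $x\in G$, $\mathrm{wt}(x)=\sum_i x_i$ and $\underline{j}=\{x\in G:\mathrm{wt}(x)=j\}$. The order $\beta\ge\alpha$ is componentwise. For $i\in[n]$ and $a\in\mathbb{N}$, $Y_i^{(a)}=X_i(X_i-1)\cdots(X_i-a+1)$, and for $\alpha\in\mathbb{N}^n$, $\mathbb{Y}^{(\alpha)}=\prod_{i=1}^nY_i^{(\alpha_i)}$. -}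

module Defs where

open import Data.Nat using (ℕ; zero; suc; _+_; _*_; _∸_; _≤_; _<_; _≤?_)
open import Data.Nat.Properties using (_≟_)
open import Data.List using (List; []; _∷_; [_]; map; concatMap; upTo; filter)
open import Data.Vec using (Vec; []; _∷_)
import Data.Vec as V
open import Data.Vec.Relation.Binary.Pointwise.Inductive using (Pointwise; decidable)
open import Relation.Binary.PropositionalEquality using (_≡_)
open import Relation.Nullary.Decidable using (_×-dec_)
import Data.Nat.ListAction as L

InG : ∀ {n} → Vec ℕ n → Vec ℕ n → Set
InG k x = Pointwise _<_ x k

grid : ∀ {n} → Vec ℕ n → List (Vec ℕ n)
grid []       = [ [] ]
grid (k ∷ ks) = concatMap (λ a → map (a ∷_) (grid ks)) (upTo k)

wt : ∀ {n} → Vec ℕ n → ℕ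
wt = V.sum

bigN : ∀ {n} → Vec ℕ n → ℕ
bigN k = V.sum (V.map (λ a → a ∸ 1) k)

_≤ᶜ_ : ∀ {n} → Vec ℕ n → Vec ℕ n → Set
α ≤ᶜ β = Pointwise _≤_ α β

-- falling factorial X (X-1) ⋯ (X-a+1) evaluated at x ∈ ℕ
-- (truncated subtraction is harmless: if a > x a factor (x - x) = 0 occurs)
falling : ℕ → ℕ → ℕ
falling x zero    = 1
falling x (suc a) = falling x a * (x ∸ a)

Yα : ∀ {n} → Vec ℕ n → Vec ℕ n → ℕ
Yα []       []       = 1
Yα (a ∷ as) (x ∷ xs) = falling x a * Yα as xs

sumAbove : ∀ {n} → Vec ℕ n → ℕ → Vec ℕ n → Vec ℕ n → ℕ
sumAbove k d α x =
  L.sum (map (λ β → Yα β x)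
             (filter (λ β → (wt β ≟ suc d) ×-dec decidable _≤?_ α β) (grid k)))

{-# OPTIONS --safe #-}
-- Only the points β = α + eᵢ lie above α with weight wt α + 1, and
-- 𝕐^(α+eᵢ)(x) = 𝕐^(α)(x)·(xᵢ − αᵢ), so the right-hand sum is 𝕐^(α)(x)·Σᵢ(xᵢ − αᵢ).
-- When α ≤ x this factor is wt x − wt α = w − d; otherwise 𝕐^(α)(x) = 0.
-- If αᵢ = kᵢ − 1 the point α + eᵢ leaves G, but then xᵢ − αᵢ = 0 as well.
module Submission where

open import Defs
open import Data.Nat using (ℕ; zero; suc; _+_; _*_; _∸_; _≤_; _<_; _≤?_; z≤n; s≤s; s≤s⁻¹)
open import Data.Nat.Properties
open import Data.Vec using (Vec; []; _∷_)
open import Data.Vec.Relation.Unary.All using (All)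
open import Data.Vec.Relation.Binary.Pointwise.Inductive using ([]; _∷_; decidable)
open import Data.List using (List; []; _∷_; _++_; map; concatMap; filter; applyUpTo; upTo)
open import Data.List.Properties using (map-++; map-∘)
import Data.Nat.ListAction as L
open import Data.Nat.ListAction.Properties using (sum-++)
open import Data.Product using (_×_; _,_)
open import Data.Sum using (_⊎_; inj₁; inj₂)
open import Function using (_∘_; _⇔_; mk⇔; Equivalence)
open import Relation.Nullary using (Dec; yes; no; ¬_; contradiction)
open import Relation.Nullary.Decidable using (_×-dec_)
open import Relation.Unary using (Pred; Decidable)
open import Relation.Binary.PropositionalEquality
open import Data.Nat.Solver using (module +-*-Solver)
open +-*-Solver using (solve; _:=_; _:+_; _:*_)

indicator : ∀ {P : Set} → Dec P → ℕ → ℕ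
indicator (yes _) v = v
indicator (no _)  v = 0

indicator-reject : ∀ {P : Set} (P? : Dec P) {v} → ¬ P → indicator P? v ≡ 0
indicator-reject (yes p) ¬p = contradiction p ¬p
indicator-reject (no _)  ¬p = refl

indicator-of-zero : ∀ {P : Set} (P? : Dec P) {v} → v ≡ 0 → indicator P? v ≡ 0
indicator-of-zero (yes _) v≡0 = v≡0
indicator-of-zero (no _)  v≡0 = refl

indicator-cong : ∀ {P Q : Set} (P? : Dec P) (Q? : Dec Q) {v} → P ⇔ Q →
                 indicator P? v ≡ indicator Q? v
indicator-cong (yes _) (yes _) P⇔Q = refl
indicator-cong (yes p) (no ¬q) P⇔Q = contradiction (Equivalence.to P⇔Q p) ¬q
indicator-cong (no ¬p) (yes q) P⇔Q = contradiction (Equivalence.from P⇔Q q) ¬p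
indicator-cong (no _)  (no _)  P⇔Q = refl

indicator-*ˡ : ∀ {P : Set} (P? : Dec P) c v → indicator P? (c * v) ≡ c * indicator P? v
indicator-*ˡ (yes _) c v = refl
indicator-*ˡ (no _)  c v = sym (*-zeroʳ c)

sum-filter : ∀ {A : Set} {P : Pred A _} (P? : Decidable P) (f : A → ℕ) (xs : List A) →
             L.sum (map f (filter P? xs)) ≡ L.sum (map (λ z → indicator (P? z) (f z)) xs)
sum-filter P? f []       = refl
sum-filter P? f (x ∷ xs) with P? x
... | yes _ = cong (f x +_) (sum-filter P? f xs)
... | no _  = sum-filter P? f xs

sum-map-concatMap : ∀ {A B : Set} (h : B → ℕ) (f : A → List B) (xs : List A) →
                    L.sum (map h (concatMap f xs)) ≡ L.sum (map (λ a → L.sum (map h (f a))) xs)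
sum-map-concatMap h f []       = refl
sum-map-concatMap h f (x ∷ xs) = begin
  L.sum (map h (f x ++ concatMap f xs))                ≡⟨ cong L.sum (map-++ h (f x) _) ⟩
  L.sum (map h (f x) ++ map h (concatMap f xs))        ≡⟨ sum-++ (map h (f x)) _ ⟩
  L.sum (map h (f x)) + L.sum (map h (concatMap f xs)) ≡⟨ cong (_ +_) (sum-map-concatMap h f xs) ⟩
  L.sum (map (λ a → L.sum (map h (f a))) (x ∷ xs))     ∎
  where open ≡-Reasoning

sumBelow : ℕ → (ℕ → ℕ) → ℕ
sumBelow zero    f = 0
sumBelow (suc k) f = f 0 + sumBelow k (f ∘ suc)

sumBelow-cong : ∀ k {f g : ℕ → ℕ} → (∀ b → f b ≡ g b) → sumBelow k f ≡ sumBelow k g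
sumBelow-cong zero    f≗g = refl
sumBelow-cong (suc k) f≗g = cong₂ _+_ (f≗g 0) (sumBelow-cong k (f≗g ∘ suc))

sumBelow-*ˡ : ∀ k c (f : ℕ → ℕ) → sumBelow k (λ b → c * f b) ≡ c * sumBelow k f
sumBelow-*ˡ zero    c f = sym (*-zeroʳ c)
sumBelow-*ˡ (suc k) c f =
  trans (cong (c * f 0 +_) (sumBelow-*ˡ k c (f ∘ suc))) (sym (*-distribˡ-+ c (f 0) _))

sumBelow-zero : ∀ k {f : ℕ → ℕ} → (∀ b → f b ≡ 0) → sumBelow k f ≡ 0
sumBelow-zero zero    f≗0 = refl
sumBelow-zero (suc k) f≗0 = cong₂ _+_ (f≗0 0) (sumBelow-zero k (f≗0 ∘ suc))

sum-map-applyUpTo : ∀ (g f : ℕ → ℕ) k → L.sum (map g (applyUpTo f k)) ≡ sumBelow k (g ∘ f)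
sum-map-applyUpTo g f zero    = refl
sum-map-applyUpTo g f (suc k) = cong (g (f 0) +_) (sum-map-applyUpTo g (f ∘ suc) k)

sumBelow-onePoint : ∀ k a (f : ℕ → ℕ) → a < k → (∀ b → b ≢ a → f b ≡ 0) → sumBelow k f ≡ f a
sumBelow-onePoint (suc k) zero    f _ off =
  trans (cong (f 0 +_) (sumBelow-zero k (λ b → off (suc b) λ ()))) (+-identityʳ (f 0))
sumBelow-onePoint (suc k) (suc a) f (s≤s a<k) off =
  trans (cong (_+ sumBelow k (f ∘ suc)) (off 0 λ ())) (sumBelow-onePoint k a (f ∘ suc) a<k (λ b b≢a → off (suc b) (b≢a ∘ suc-injective)))

sumBelow-twoPoint : ∀ k a (f : ℕ → ℕ) → a < k → (suc a ≡ k → f (suc a) ≡ 0) →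
                    (∀ b → b ≢ a → b ≢ suc a → f b ≡ 0) → sumBelow k f ≡ f a + f (suc a)
sumBelow-twoPoint (suc zero) zero f _ atEnd _ = cong (f 0 +_) (sym (atEnd refl))
sumBelow-twoPoint (suc (suc k)) zero f _ _ off =
  cong (f 0 +_) (trans (cong (f 1 +_) (sumBelow-zero k (λ b → off (suc (suc b)) (λ ()) (λ ()))))
                       (+-identityʳ (f 1)))
sumBelow-twoPoint (suc k) (suc a) f (s≤s a<k) atEnd off =
  trans (cong (_+ sumBelow k (f ∘ suc)) (off 0 (λ ()) (λ ())))
        (sumBelow-twoPoint k a (f ∘ suc) a<k (atEnd ∘ cong suc)
          (λ b b≢a b≢sa → off (suc b) (b≢a ∘ suc-injective) (b≢sa ∘ suc-injective)))

sumGrid : ∀ {n} → Vec ℕ n → (Vec ℕ n → ℕ) → ℕ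
sumGrid []       h = h []
sumGrid (k ∷ ks) h = sumBelow k (λ b → sumGrid ks (h ∘ (b ∷_)))

sumGrid-cong : ∀ {n} (k : Vec ℕ n) {g h : Vec ℕ n → ℕ} → (∀ β → g β ≡ h β) → sumGrid k g ≡ sumGrid k h
sumGrid-cong []       g≗h = g≗h []
sumGrid-cong (k ∷ ks) g≗h = sumBelow-cong k (λ b → sumGrid-cong ks (g≗h ∘ (b ∷_)))

sumGrid-*ˡ : ∀ {n} (k : Vec ℕ n) c (h : Vec ℕ n → ℕ) → sumGrid k (λ β → c * h β) ≡ c * sumGrid k h
sumGrid-*ˡ []       c h = refl
sumGrid-*ˡ (k ∷ ks) c h =
  trans (sumBelow-cong k (λ b → sumGrid-*ˡ ks c (h ∘ (b ∷_)))) (sumBelow-*ˡ k c _)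

sumGrid-zero : ∀ {n} (k : Vec ℕ n) {h : Vec ℕ n → ℕ} → (∀ β → h β ≡ 0) → sumGrid k h ≡ 0
sumGrid-zero []       h≗0 = h≗0 []
sumGrid-zero (k ∷ ks) h≗0 = sumBelow-zero k (λ b → sumGrid-zero ks (h≗0 ∘ (b ∷_)))

sum-map-grid : ∀ {n} (k : Vec ℕ n) (h : Vec ℕ n → ℕ) → L.sum (map h (grid k)) ≡ sumGrid k h
sum-map-grid []       h = +-identityʳ (h [])
sum-map-grid (k ∷ ks) h = begin
  L.sum (map h (concatMap (λ a → map (a ∷_) (grid ks)) (upTo k)))
    ≡⟨ sum-map-concatMap h _ (upTo k) ⟩
  L.sum (map (λ a → L.sum (map h (map (a ∷_) (grid ks)))) (upTo k))
    ≡⟨ sum-map-applyUpTo _ (λ a → a) k ⟩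
  sumBelow k (λ a → L.sum (map h (map (a ∷_) (grid ks))))
    ≡⟨ sumBelow-cong k (λ a → cong L.sum (sym (map-∘ (grid ks)))) ⟩
  sumBelow k (λ a → L.sum (map (h ∘ (a ∷_)) (grid ks)))
    ≡⟨ sumBelow-cong k (λ a → sum-map-grid ks (h ∘ (a ∷_))) ⟩
  sumGrid (k ∷ ks) h ∎
  where open ≡-Reasoning

wt-mono : ∀ {n} {α β : Vec ℕ n} → α ≤ᶜ β → wt α ≤ wt β
wt-mono []            = z≤n
wt-mono (a≤b ∷ as≤bs) = +-mono-≤ a≤b (wt-mono as≤bs)

falling-< : ∀ {y a} → y < a → falling y a ≡ 0
falling-< {y} {suc a} y<1+a with m≤n⇒m<n∨m≡n (s≤s⁻¹ y<1+a)
... | inj₁ y<a  = cong (_* (y ∸ a)) (falling-< y<a)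
... | inj₂ refl = trans (cong (falling y y *_) (n∸n≡0 y)) (*-zeroʳ (falling y y))

Yα≡0⊎≤ᶜ : ∀ {n} (α x : Vec ℕ n) → Yα α x ≡ 0 ⊎ α ≤ᶜ x
Yα≡0⊎≤ᶜ []       []       = inj₂ []
Yα≡0⊎≤ᶜ (a ∷ as) (y ∷ xs) with a ≤? y | Yα≡0⊎≤ᶜ as xs
... | no a≰y  | _          = inj₁ (cong (_* Yα as xs) (falling-< (≰⇒> a≰y)))
... | yes _   | inj₁ Y≡0   = inj₁ (trans (cong (falling y a *_) Y≡0) (*-zeroʳ (falling y a)))
... | yes a≤y | inj₂ as≤xs = inj₂ (a≤y ∷ as≤xs)

gap : ∀ {n} → Vec ℕ n → Vec ℕ n → ℕ
gap []       []       = 0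
gap (a ∷ as) (y ∷ xs) = (y ∸ a) + gap as xs

gap≡wt∸wt : ∀ {n} {α x : Vec ℕ n} → α ≤ᶜ x → gap α x ≡ wt x ∸ wt α
gap≡wt∸wt [] = refl
gap≡wt∸wt {α = a ∷ as} {y ∷ xs} (a≤y ∷ as≤xs) = begin
  (y ∸ a) + gap as xs            ≡⟨ cong ((y ∸ a) +_) (gap≡wt∸wt as≤xs) ⟩
  (y ∸ a) + (wt xs ∸ wt as)      ≡⟨ sym (+-∸-assoc (y ∸ a) (wt-mono as≤xs)) ⟩
  (y ∸ a) + wt xs ∸ wt as        ≡⟨ cong (_∸ wt as) (sym (+-∸-comm (wt xs) a≤y)) ⟩
  y + wt xs ∸ a ∸ wt as          ≡⟨ ∸-+-assoc (y + wt xs) a (wt as) ⟩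
  y + wt xs ∸ (a + wt as)        ∎
  where open ≡-Reasoning

Yα*gap≡wt∸wt*Yα : ∀ {n} (α x : Vec ℕ n) → Yα α x * gap α x ≡ (wt x ∸ wt α) * Yα α x
Yα*gap≡wt∸wt*Yα α x with Yα≡0⊎≤ᶜ α x
... | inj₁ Y≡0 = begin
  Yα α x * gap α x          ≡⟨ cong (_* gap α x) Y≡0 ⟩
  0                         ≡⟨ sym (*-zeroʳ (wt x ∸ wt α)) ⟩
  (wt x ∸ wt α) * 0         ≡⟨ cong ((wt x ∸ wt α) *_) (sym Y≡0) ⟩
  (wt x ∸ wt α) * Yα α x    ∎
  where open ≡-Reasoning
... | inj₂ α≤x = trans (cong (Yα α x *_) (gap≡wt∸wt α≤x)) (*-comm (Yα α x) (wt x ∸ wt α))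

AboveWithWeight : ∀ {n} → ℕ → Vec ℕ n → Vec ℕ n → Set
AboveWithWeight m α β = (wt β ≡ m) × (α ≤ᶜ β)

aboveWithWeight? : ∀ {n} (m : ℕ) (α β : Vec ℕ n) → Dec (AboveWithWeight m α β)
aboveWithWeight? m α β = (wt β ≟ m) ×-dec decidable _≤?_ α β

aboveWithWeight-∷ : ∀ {n a b m M} {as β : Vec ℕ n} → b + m ≡ M → a ≤ b →
                    AboveWithWeight M (a ∷ as) (b ∷ β) ⇔ AboveWithWeight m as β
aboveWithWeight-∷ {b = b} b+m≡M a≤b = mk⇔
  (λ { (wt≡M , _ ∷ as≤β) → +-cancelˡ-≡ b _ _ (trans wt≡M (sym b+m≡M)) , as≤β })
  (λ { (wt≡m , as≤β) → trans (cong (b +_) wt≡m) b+m≡M , a≤b ∷ as≤β })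

indicator-aboveWithWeight-∷ : ∀ {n a b} m M (as β : Vec ℕ n) {v} → b + m ≡ M → a ≤ b →
  indicator (aboveWithWeight? M (a ∷ as) (b ∷ β)) v ≡ indicator (aboveWithWeight? m as β) v
indicator-aboveWithWeight-∷ {a = a} {b} m M as β b+m≡M a≤b =
  indicator-cong (aboveWithWeight? M (a ∷ as) (b ∷ β)) (aboveWithWeight? m as β) (aboveWithWeight-∷ b+m≡M a≤b)

aboveWithWeight-head : ∀ {n a b M} {as β : Vec ℕ n} → AboveWithWeight M (a ∷ as) (b ∷ β) →
                       a ≤ b × b + wt as ≤ M
aboveWithWeight-head {b = b} (refl , a≤b ∷ as≤β) = a≤b , +-monoʳ-≤ b (wt-mono as≤β)

sumGrid-aboveWithSameWeight : ∀ {n} (k α : Vec ℕ n) → InG k α → (h : Vec ℕ n → ℕ) →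
  sumGrid k (λ β → indicator (aboveWithWeight? (wt α) α β) (h β)) ≡ h α
sumGrid-aboveWithSameWeight []       []       []             h = refl
sumGrid-aboveWithSameWeight (k ∷ ks) (a ∷ as) (a<k ∷ as∈G) h = begin
  sumBelow k (λ b → sumGrid ks (λ β → indicator (aboveWithWeight? (a + wt as) (a ∷ as) (b ∷ β)) (h (b ∷ β))))
    ≡⟨ sumBelow-onePoint k a _ a<k onlyAtA ⟩
  sumGrid ks (λ β → indicator (aboveWithWeight? (a + wt as) (a ∷ as) (a ∷ β)) (h (a ∷ β)))
    ≡⟨ sumGrid-cong ks (λ β → indicator-aboveWithWeight-∷ (wt as) (a + wt as) as β refl ≤-refl) ⟩
  sumGrid ks (λ β → indicator (aboveWithWeight? (wt as) as β) (h (a ∷ β)))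
    ≡⟨ sumGrid-aboveWithSameWeight ks as as∈G (h ∘ (a ∷_)) ⟩
  h (a ∷ as) ∎
  where
  open ≡-Reasoning
  onlyAtA : ∀ b → b ≢ a →
    sumGrid ks (λ β → indicator (aboveWithWeight? (a + wt as) (a ∷ as) (b ∷ β)) (h (b ∷ β))) ≡ 0
  onlyAtA b b≢a = sumGrid-zero ks λ β → indicator-reject (aboveWithWeight? (a + wt as) (a ∷ as) (b ∷ β)) λ above →
    let a≤b , b+A≤a+A = aboveWithWeight-head above
    in b≢a (≤-antisym (+-cancelʳ-≤ (wt as) b a b+A≤a+A) a≤b)

sumGrid-aboveWithNextWeight : ∀ {n} (k α x : Vec ℕ n) → InG k α → InG k x →
  sumGrid k (λ β → indicator (aboveWithWeight? (suc (wt α)) α β) (Yα β x)) ≡ Yα α x * gap α x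
sumGrid-aboveWithNextWeight []       []       []       []             []           = refl
sumGrid-aboveWithNextWeight (k ∷ ks) (a ∷ as) (y ∷ xs) (a<k ∷ as∈G) (y<k ∷ xs∈G) = begin
  sumBelow k F                                                   ≡⟨ sumBelow-twoPoint k a F a<k leavesGrid onlyAtAorNext ⟩
  F a + F (suc a)                                                ≡⟨ cong₂ _+_ stay step ⟩
  falling y a * (Yα as xs * gap as xs) + falling y a * (y ∸ a) * Yα as xs
    ≡⟨ solve 4 (λ f Y D t → f :* (Y :* D) :+ f :* t :* Y := f :* Y :* (t :+ D)) refl
         (falling y a) (Yα as xs) (gap as xs) (y ∸ a) ⟩
  falling y a * Yα as xs * ((y ∸ a) + gap as xs)                 ∎
  where
  open ≡-Reasoning
  A = wt as

  F : ℕ → ℕ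
  F b = sumGrid ks (λ β → indicator (aboveWithWeight? (suc (a + A)) (a ∷ as) (b ∷ β)) (falling y b * Yα β xs))

  onlyAtAorNext : ∀ b → b ≢ a → b ≢ suc a → F b ≡ 0
  onlyAtAorNext b b≢a b≢1+a = sumGrid-zero ks λ β → indicator-reject (aboveWithWeight? (suc (a + A)) (a ∷ as) (b ∷ β)) λ above →
    let a≤b , b+A≤1+a+A = aboveWithWeight-head above
        b<1+a = ≤∧≢⇒< (+-cancelʳ-≤ A b (suc a) b+A≤1+a+A) b≢1+a
    in b≢a (≤-antisym (s≤s⁻¹ b<1+a) a≤b)

  leavesGrid : suc a ≡ k → F (suc a) ≡ 0
  leavesGrid 1+a≡k = sumGrid-zero ks λ β → indicator-of-zero (aboveWithWeight? (suc (a + A)) (a ∷ as) (suc a ∷ β))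
    (cong (_* Yα β xs) (falling-< (subst (y <_) (sym 1+a≡k) y<k)))

  stay : F a ≡ falling y a * (Yα as xs * gap as xs)
  stay = begin
    F a
      ≡⟨ sumGrid-cong ks (λ β → indicator-aboveWithWeight-∷ (suc A) (suc (a + A)) as β (+-suc a A) ≤-refl) ⟩
    sumGrid ks (λ β → indicator (aboveWithWeight? (suc A) as β) (falling y a * Yα β xs))
      ≡⟨ sumGrid-cong ks (λ β → indicator-*ˡ (aboveWithWeight? (suc A) as β) (falling y a) (Yα β xs)) ⟩
    sumGrid ks (λ β → falling y a * indicator (aboveWithWeight? (suc A) as β) (Yα β xs))
      ≡⟨ sumGrid-*ˡ ks (falling y a) _ ⟩
    falling y a * sumGrid ks (λ β → indicator (aboveWithWeight? (suc A) as β) (Yα β xs))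
      ≡⟨ cong (falling y a *_) (sumGrid-aboveWithNextWeight ks as xs as∈G xs∈G) ⟩
    falling y a * (Yα as xs * gap as xs) ∎

  step : F (suc a) ≡ falling y (suc a) * Yα as xs
  step = begin
    F (suc a)
      ≡⟨ sumGrid-cong ks (λ β → indicator-aboveWithWeight-∷ A (suc (a + A)) as β refl (n≤1+n a)) ⟩
    sumGrid ks (λ β → indicator (aboveWithWeight? A as β) (falling y (suc a) * Yα β xs))
      ≡⟨ sumGrid-aboveWithSameWeight ks as as∈G (λ β → falling y (suc a) * Yα β xs) ⟩
    falling y (suc a) * Yα as xs ∎

lemma3p3 : (n : ℕ) (k : Vec ℕ n) → All (2 ≤_) k →
           (d w : ℕ) → d ≤ bigN k → w ≤ bigN k → d < w →
           (α : Vec ℕ n) → InG k α → wt α ≡ d →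
           (x : Vec ℕ n) → InG k x → wt x ≡ w →
           (w ∸ d) * Yα α x ≡ sumAbove k d α x
lemma3p3 n k _ d w _ _ _ α α∈G refl x x∈G refl = sym (begin
  sumAbove k (wt α) α x
    ≡⟨ sum-filter (aboveWithWeight? (suc (wt α)) α) (λ β → Yα β x) (grid k) ⟩
  L.sum (map (λ β → indicator (aboveWithWeight? (suc (wt α)) α β) (Yα β x)) (grid k))
    ≡⟨ sum-map-grid k _ ⟩
  sumGrid k (λ β → indicator (aboveWithWeight? (suc (wt α)) α β) (Yα β x))
    ≡⟨ sumGrid-aboveWithNextWeight k α x α∈G x∈G ⟩
  Yα α x * gap α x
    ≡⟨ Yα*gap≡wt∸wt*Yα α x ⟩
  (wt x ∸ wt α) * Yα α x ∎)
  where open ≡-Reasoning
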